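{- Let $S$ be a connected graph in which every node $u$ holds a message $m_{uv}$ designated to each neighbor $v\in\mathcal{N}_u(S)$, and let $r$ be a designated initiator. When Algorithm 3 (described in the context) is executed in the asynchronous model, by its end each node $u$ receives the message $m_{vu}$ from every node $v\in\mathcal{N}_u(S)$, and all nodes are in state $\mathsf{DONE}$.
   Context: Asynchronous model: no timing assumptions; a node is asleep until it receives a message, then computes, sends messages and sleeps; channels not assumed FIFO; messages are delayed by arbitrary finite amounts. $\mathcal{N}_u(S)$ is the set of neighbors of $u$ in $S$. Algorithm 3 (root-triggered synchronizer for one round): all nodes start in state $\mathsf{INIT}$. The initiator $r$ sets state $\mathsf{ACTIVE}$, $\mathit{parent}_r=\bot$, $\mathit{children}_r=\mathcal{N}_r(S)$, sends $m_{rv}$ to each $v\in\mathit{children}_r$, waits to receive $m_{vr}$ from every $v\in\mathit{children}_r$, and sets state $\mathsf{DONE}$. Every node $u$, upon receiving a message from $w$ while in state $\mathsf{INIT}$, sets state $\mathsf{ACTIVE}$, $\mathit{parent}_u=w$, $\mathit{children}_u=\mathcal{N}_u(S)\setminus\{w\}$, sends $m_{uv}$ to each $v\in\mathit{children}_u$, waits to receive $m_{vu}$ from every $v\in\mathit{children}_u$, then sends $m_{uw}$ to $w$ and sets state $\mathsf{DONE}$. -}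

module Defs where

open import Data.Nat using (ℕ)
open import Data.Fin using (Fin; _≟_)
open import Data.List using (List; []; _∷_; _++_; map; filter; allFin)
open import Data.Maybe using (Maybe; just; nothing)
open import Data.Product using (_×_; _,_; proj₁; proj₂)
open import Data.Bool using (if_then_else_)
open import Relation.Nullary using (¬_; Dec; does; ¬?)
open import Relation.Binary.PropositionalEquality using (_≡_)
open import Relation.Binary.Construct.Closure.ReflexiveTransitive using (Star)

record Graph (n : ℕ) : Set₁ where
  field
    Adj    : Fin n → Fin n → Set
    adj?   : ∀ u v → Dec (Adj u v)
    sym    : ∀ {u v} → Adj u v → Adj v u
    irrefl : ∀ {u} → ¬ Adj u u

open Graph public

Connected : ∀ {n} → Graph n → Set
Connected G = ∀ u v → Star (Adj G) u v

nbrs : ∀ {n} → Graph n → Fin n → List (Fin n)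
nbrs {n} G u = filter (adj? G u) (allFin n)

data Status : Set where
  INIT ACTIVE DONE : Status

-- local state of a node: algorithm variables plus the log of received
-- messages (sender, content), and the set of children not yet heard from
record Local (n : ℕ) (M : Set) : Set where
  constructor local
  field
    status   : Status
    parent   : Maybe (Fin n)
    children : List (Fin n)
    waiting  : List (Fin n)
    log      : List (Fin n × M)

open Local public

-- a message in transit: (sender, receiver, content)
Msg : ℕ → Set → Set
Msg n M = Fin n × Fin n × M

record Config (n : ℕ) (M : Set) : Set where
  constructor config
  field
    nodes   : Fin n → Local n M
    pending : List (Msg n M)   -- unordered multiset of messages in transit

open Config public

module Algorithm3 {n : ℕ} (G : Graph n) {M : Set} (m : Fin n → Fin n → M) where

  sendAll : Fin n → List (Fin n) → List (Msg n M)
  sendAll u vs = map (λ v → (u , v , m u v)) vs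

  toParent : Fin n → Maybe (Fin n) → List (Msg n M)
  toParent u nothing  = []
  toParent u (just w) = (u , w , m u w) ∷ []

  tryFinish : Fin n → Local n M → List (Msg n M) → Local n M × List (Msg n M)
  tryFinish u s out with waiting s
  ... | []    = record s { status = DONE } , out ++ toParent u (parent s)
  ... | _ ∷ _ = record s { status = ACTIVE } , out

  removeFrom : Fin n → List (Fin n) → List (Fin n)
  removeFrom w = filter (λ v → ¬? (v ≟ w))

  react : Fin n → Local n M → Fin n → M → Local n M × List (Msg n M)
  react u s w x with status s
  ... | INIT   = let ch = removeFrom w (nbrs G u) in
                 tryFinish u (local ACTIVE (just w) ch ch ((w , x) ∷ log s)) (sendAll u ch)
  ... | ACTIVE = tryFinish u (record s { waiting = removeFrom w (waiting s)
                                       ; log = (w , x) ∷ log s }) []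
  ... | DONE   = record s { log = (w , x) ∷ log s } , []

  update : Fin n → Local n M → (Fin n → Local n M) → Fin n → Local n M
  update u s f v = if does (v ≟ u) then s else f v

  -- one asynchronous step: ANY message in transit (no FIFO) is delivered
  data Step (c : Config n M) : Config n M → Set where
    deliver : ∀ xs w u x ys → pending c ≡ xs ++ (w , u , x) ∷ ys →
      Step c (config (update u (proj₁ (react u (nodes c u) w x)) (nodes c))
                     (xs ++ ys ++ proj₂ (react u (nodes c u) w x)))

  initLocal : Local n M
  initLocal = local INIT nothing [] [] []

  -- configuration right after the initiator r performs its spontaneous action
  initial : Fin n → Config n M
  initial r = config
    (update r (proj₁ (tryFinish r (local ACTIVE nothing (nbrs G r) (nbrs G r) []) []))
              (λ _ → initLocal))
    (sendAll r (nbrs G r))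

-- Every node carries a budget of messages it may still send
-- (n+1 while asleep, one report to its parent while active with a parent,
-- none once done).  A delivery removes one message from transit and the
-- receiver's reaction sends at most what its budget shrinks by, so the
-- potential "messages in transit + total budget" strictly decreases along
-- every step; hence the step relation is well-founded.
--
-- From them we show that a global invariant
-- holds in every reachable configuration: nodes are locally coherent, the
-- root has started, parents have started, messages travel along edges from
-- started nodes, every message a node has already sent is in transit or
-- logged by its receiver, and parent pointers admit a ranking.
--
-- When nothing is in transit, "started" spreads along edges, so
-- by connectivity every node has started; an active node would wait for a
-- child that is itself active, which the ranking forbids.  So every node is
-- done, and a done neighbour has delivered its message.

module Submission where

open import Defs hiding (sym)
open import Data.Bool using (if_then_else_)
open import Data.Empty using (⊥-elim)
open import Data.Fin using (Fin; _≟_; punchIn)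
open import Data.Fin.Properties using (punchInᵢ≢i)
open import Data.List using (List; []; _∷_; _++_; length; allFin)
open import Data.List.Membership.Propositional using (_∈_; _∉_)
open import Data.List.Membership.Propositional.Properties
  using (∈-filter⁻; ∈-filter⁺; ∈-allFin; ∈-map⁺; ∈-map⁻; ∈-++⁺ˡ; ∈-++⁺ʳ; ∈-++⁻)
open import Data.List.Properties using (length-filter; length-map; length-++; length-tabulate; ++-identityʳ)
open import Data.List.Relation.Unary.Any using (here; there)
open import Data.Maybe using (Maybe; just; nothing)
import Data.Maybe.Properties as Maybe
open import Data.Nat using (ℕ; suc; _+_; _<_; _≤_; z≤n; s≤s)
open import Data.Nat.Induction using (<-wellFounded)
open import Data.Nat.Properties using (+-0-commutativeMonoid; +-identityʳ; +-comm; ≤-reflexive; n<1+n; +-monoʳ-≤; module ≤-Reasoning)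
open import Data.Nat.Tactic.RingSolver using (solve-∀)
open import Data.Product using (Σ; ∃; _×_; _,_; proj₁; proj₂)
open import Data.Sum as Sum using (_⊎_; inj₁; inj₂; map₂)
open import Function using (_∘_)
open import Induction.WellFounded using (Acc; acc; WellFounded; module Subrelation)
open import Relation.Binary.Construct.Closure.ReflexiveTransitive using (Star; ε; _◅_)
import Relation.Binary.Construct.On as On
open import Relation.Nullary using (Dec; yes; no; does; ¬_; ¬?)
open import Relation.Binary.PropositionalEquality

open import Algebra.Properties.CommutativeMonoid.Sum +-0-commutativeMonoid using (sum; sum-remove; sum-cong-≗)

Ranked : {A : Set} → (A → A → Set) → Set
Ranked {A} R = Σ (A → ℕ) λ h → ∀ {x y} → R x y → h x < h y

ranked⇒wf : ∀ {A : Set} {R : A → A → Set} → Ranked R → WellFounded R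
ranked⇒wf (h , h<) = Subrelation.wellFounded h< (On.wellFounded h <-wellFounded)

-- A ranking survives the attachment of edges leaving a fresh node u: if every
-- new edge a → b avoids u as target and is old unless it starts at u, then
-- putting u at height 0 and lifting everyone else ranks the new relation.
ranked-attach : ∀ {k} {R R′ : Fin k → Fin k → Set} (u : Fin k) → Ranked R →
                (∀ {a b} → R′ a b → b ≢ u × (a ≡ u ⊎ R a b)) → Ranked R′
ranked-attach {R′ = R′} u (h , h<) fresh = lift , lift<
  where
  lift : Fin _ → ℕ
  lift a = if does (a ≟ u) then 0 else suc (h a)

  lift< : ∀ {a b} → R′ a b → lift a < lift b
  lift< {a} {b} r with fresh r | a ≟ u | b ≟ u
  ... | b≢u , _         | _       | yes b≡u = ⊥-elim (b≢u b≡u)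
  ... | _               | yes _   | no _    = s≤s z≤n
  ... | _ , inj₁ a≡u    | no a≢u  | no _    = ⊥-elim (a≢u a≡u)
  ... | _ , inj₂ old    | no _    | no _    = s≤s (h< old)

sum-update : ∀ {k} (g h : Fin k → ℕ) (i : Fin k) → (∀ j → j ≢ i → h j ≡ g j) →
             ∃ λ rest → sum g ≡ g i + rest × sum h ≡ h i + rest
sum-update {suc k} g h i agree =
  sum (g ∘ punchIn i) ,
  sum-remove g ,
  trans (sum-remove h) (cong (h i +_) (sum-cong-≗ (λ j → agree (punchIn i j) (punchInᵢ≢i i j))))

module Synchronizer {n : ℕ} (G : Graph n) {M : Set} (m : Fin n → Fin n → M) where
  open Algorithm3 G m

  ∈-nbrs⁻ : ∀ {u v} → v ∈ nbrs G u → Adj G u v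
  ∈-nbrs⁻ {u} v∈ = proj₂ (∈-filter⁻ (adj? G u) {xs = allFin n} v∈)

  ∈-nbrs⁺ : ∀ {u v} → Adj G u v → v ∈ nbrs G u
  ∈-nbrs⁺ {u} {v} uv = ∈-filter⁺ (adj? G u) (∈-allFin v) uv

  -- the children of u when it is woken up by w: its neighbours other than w
  ∈-others⁻ : ∀ {u v w} → v ∈ removeFrom w (nbrs G u) → Adj G u v × v ≢ w
  ∈-others⁻ {w = w} v∈ with ∈-filter⁻ (λ v → ¬? (v ≟ w)) v∈
  ... | v∈nbrs , v≢w = ∈-nbrs⁻ v∈nbrs , v≢w

  ∈-others⁺ : ∀ {u v w} → Adj G u v → v ≢ w → v ∈ removeFrom w (nbrs G u)
  ∈-others⁺ {w = w} uv v≢w = ∈-filter⁺ (λ v → ¬? (v ≟ w)) (∈-nbrs⁺ uv) v≢w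

  others-bound : ∀ u w → length (removeFrom w (nbrs G u)) ≤ n
  others-bound u w = begin
    length (removeFrom w (nbrs G u)) ≤⟨ length-filter _ (nbrs G u) ⟩
    length (nbrs G u)                ≤⟨ length-filter (adj? G u) (allFin n) ⟩
    length (allFin n)                ≡⟨ length-tabulate (λ i → i) ⟩
    n                                ∎
    where open ≤-Reasoning

  ∈-sendAll⁺ : ∀ {u v vs} → v ∈ vs → (u , v , m u v) ∈ sendAll u vs
  ∈-sendAll⁺ {u} = ∈-map⁺ (λ v → (u , v , m u v))

  ∈-sendAll⁻ : ∀ {u a b z vs} → (a , b , z) ∈ sendAll u vs → a ≡ u × b ∈ vs
  ∈-sendAll⁻ {u} e∈ with ∈-map⁻ (λ v → (u , v , m u v)) e∈
  ... | v , v∈ , refl = refl , v∈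

  settle : List (Fin n) → Status
  settle []      = DONE
  settle (_ ∷ _) = ACTIVE

  report : Fin n → List (Fin n) → Maybe (Fin n) → List (Msg n M)
  report u []      p = toParent u p
  report u (_ ∷ _) p = []

  tryFinish-spec : ∀ u st p ch ws lg out →
    tryFinish u (local st p ch ws lg) out ≡ (local (settle ws) p ch ws lg , out ++ report u ws p)
  tryFinish-spec u st p ch []      lg out = refl
  tryFinish-spec u st p ch (_ ∷ _) lg out = cong (_ ,_) (sym (++-identityʳ out))

  reaction : Fin n → Local n M → Fin n → M → Local n M × List (Msg n M)
  reaction u (local INIT _ _ _ lg) w x =
    let C = removeFrom w (nbrs G u) in
    local (settle C) (just w) C C ((w , x) ∷ lg) , sendAll u C ++ report u C (just w)
  reaction u (local ACTIVE p ch wt lg) w x =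
    let W = removeFrom w wt in
    local (settle W) p ch W ((w , x) ∷ lg) , report u W p
  reaction u (local DONE p ch wt lg) w x = local DONE p ch wt ((w , x) ∷ lg) , []

  react-spec : ∀ u s w x → react u s w x ≡ reaction u s w x
  react-spec u (local INIT p ch wt lg) w x =
    let C = removeFrom w (nbrs G u) in tryFinish-spec u ACTIVE (just w) C C ((w , x) ∷ lg) (sendAll u C)
  react-spec u (local ACTIVE p ch wt lg) w x =
    tryFinish-spec u ACTIVE p ch (removeFrom w wt) ((w , x) ∷ lg) []
  react-spec u (local DONE p ch wt lg) w x = refl

  Started : Local n M → Set
  Started s = status s ≢ INIT

  init? : ∀ st → Dec (st ≡ INIT)
  init? INIT   = yes refl
  init? ACTIVE = no λ ()
  init? DONE   = no λ ()

  ParentOf : (Fin n → Local n M) → Fin n → Fin n → Set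
  ParentOf N a b = parent (N a) ≡ just b

  Phase : Status → Local n M → Set
  Phase INIT   s = log s ≡ []
  Phase ACTIVE s = ∃ λ v → v ∈ waiting s
  Phase DONE   s = waiting s ≡ []

  record Coherent (u : Fin n) (s : Local n M) : Set where
    field
      phase           : Phase (status s) s
      waiting-adj     : ∀ {v} → v ∈ waiting s → Adj G u v
      waiting-unheard : ∀ {v z} → v ∈ waiting s → (v , z) ∉ log s
      parent-adj      : ∀ {v} → parent s ≡ just v → Adj G u v

  -- s has already sent its message to b: it is done, or active and b is not
  -- its parent (children are served when the node wakes up)
  data HasSent (s : Local n M) (b : Fin n) : Set where
    finished      : status s ≡ DONE → HasSent s b
    not-to-parent : status s ≡ ACTIVE → parent s ≢ just b → HasSent s b

  sent-or-parent : ∀ {s b} → Started s → HasSent s b ⊎ (status s ≡ ACTIVE × parent s ≡ just b)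
  sent-or-parent {local INIT _ _ _ _} started = ⊥-elim (started refl)
  sent-or-parent {local DONE _ _ _ _} started = inj₁ (finished refl)
  sent-or-parent {local ACTIVE p _ _ _} {b} started with Maybe.≡-dec _≟_ p (just b)
  ... | yes p≡b = inj₂ (refl , p≡b)
  ... | no p≢b  = inj₁ (not-to-parent refl p≢b)

  settle-started : ∀ ws → settle ws ≢ INIT
  settle-started []      ()
  settle-started (_ ∷ _) ()

  settle-phase : ∀ p ch ws lg → Phase (settle ws) (local (settle ws) p ch ws lg)
  settle-phase p ch []      lg = refl
  settle-phase p ch (v ∷ _) lg = v , here refl

  toParent-covers : ∀ u p b → p ≢ just b ⊎ (u , b , m u b) ∈ toParent u p
  toParent-covers u nothing  b = inj₁ λ ()
  toParent-covers u (just q) b with q ≟ b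
  ... | yes refl = inj₂ (here refl)
  ... | no q≢b   = inj₁ (q≢b ∘ Maybe.just-injective)

  settle-sent : ∀ {u p ch lg b} ws → HasSent (local (settle ws) p ch ws lg) b →
                p ≢ just b ⊎ (u , b , m u b) ∈ report u ws p
  settle-sent {u} {p} {b = b} [] _     = toParent-covers u p b
  settle-sent (_ ∷ _) (finished ())
  settle-sent (_ ∷ _) (not-to-parent _ p≢b) = inj₁ p≢b

  ∈-report⁻ : ∀ {u a b z} ws p → (a , b , z) ∈ report u ws p → a ≡ u × p ≡ just b
  ∈-report⁻ [] (just q) (here refl) = refl , refl

  unheard-∷ : ∀ {v w : Fin n} {z x : M} {lg : List (Fin n × M)} → v ≢ w → (v , z) ∉ lg → (v , z) ∉ (w , x) ∷ lg
  unheard-∷ v≢w _  (here e)   = v≢w (cong proj₁ e)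
  unheard-∷ _   v∉ (there e∈) = v∉ e∈

  owed : Maybe (Fin n) → ℕ
  owed nothing  = 0
  owed (just _) = 1

  budget : Local n M → ℕ
  budget (local INIT _ _ _ _)   = suc n
  budget (local ACTIVE p _ _ _) = owed p
  budget (local DONE _ _ _ _)   = 0

  settle-budget : ∀ u p ch ws lg → budget (local (settle ws) p ch ws lg) + length (report u ws p) ≡ owed p
  settle-budget u nothing  ch []      lg = refl
  settle-budget u (just _) ch []      lg = refl
  settle-budget u p        ch (_ ∷ _) lg = +-identityʳ (owed p)

  module _ {u w : Fin n} {x : M} where

    reaction-log : ∀ s → log (proj₁ (reaction u s w x)) ≡ (w , x) ∷ log s
    reaction-log (local INIT _ _ _ _)   = refl
    reaction-log (local ACTIVE _ _ _ _) = refl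
    reaction-log (local DONE _ _ _ _)   = refl

    reaction-started : ∀ s → Started (proj₁ (reaction u s w x))
    reaction-started (local INIT _ _ _ _)     = settle-started (removeFrom w (nbrs G u))
    reaction-started (local ACTIVE _ _ wt _)  = settle-started (removeFrom w wt)
    reaction-started (local DONE _ _ _ _)     = λ ()

    reaction-parent : ∀ s {b} → parent (proj₁ (reaction u s w x)) ≡ just b →
                      (status s ≡ INIT × b ≡ w) ⊎ (Started s × parent s ≡ just b)
    reaction-parent (local INIT _ _ _ _) refl      = inj₁ (refl , refl)
    reaction-parent (local ACTIVE _ _ _ _) p≡b     = inj₂ ((λ ()) , p≡b)
    reaction-parent (local DONE _ _ _ _) p≡b       = inj₂ ((λ ()) , p≡b)

    reaction-sent : ∀ s {b} → Adj G u b → HasSent (proj₁ (reaction u s w x)) b →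
                    HasSent s b ⊎ (u , b , m u b) ∈ proj₂ (reaction u s w x)
    reaction-sent (local INIT _ _ _ _) {b} ub sent
      with settle-sent (removeFrom w (nbrs G u)) sent
    ... | inj₁ w≢b  = inj₂ (∈-++⁺ˡ (∈-sendAll⁺ (∈-others⁺ ub (λ b≡w → w≢b (cong just (sym b≡w))))))
    ... | inj₂ sent = inj₂ (∈-++⁺ʳ _ sent)
    reaction-sent (local ACTIVE _ _ wt _) ub sent
      with settle-sent (removeFrom w wt) sent
    ... | inj₁ p≢b  = inj₁ (not-to-parent refl p≢b)
    ... | inj₂ sent = inj₂ sent
    reaction-sent (local DONE _ _ _ _) ub sent = inj₁ (finished refl)

    reaction-out : ∀ s {a b z} → Adj G u w → Coherent u s →
                   (a , b , z) ∈ proj₂ (reaction u s w x) → a ≡ u × Adj G u b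
    reaction-out (local INIT _ _ _ _) uw coh e∈
      with ∈-++⁻ (sendAll u (removeFrom w (nbrs G u))) e∈
    ... | inj₁ e∈sent with ∈-sendAll⁻ e∈sent
    ...   | a≡u , b∈ = a≡u , proj₁ (∈-others⁻ b∈)
    reaction-out (local INIT _ _ _ _) uw coh e∈ | inj₂ e∈report
      with ∈-report⁻ (removeFrom w (nbrs G u)) (just w) e∈report
    ...   | a≡u , refl = a≡u , uw
    reaction-out (local ACTIVE p _ wt _) uw coh e∈ with ∈-report⁻ (removeFrom w wt) p e∈
    ... | a≡u , p≡b = a≡u , Coherent.parent-adj coh p≡b

    reaction-coherent : ∀ s → Adj G u w → Coherent u s → Coherent u (proj₁ (reaction u s w x))
    reaction-coherent (local INIT p ch wt lg) uw coh = record
      { phase           = settle-phase (just w) C C ((w , x) ∷ lg)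
      ; waiting-adj     = proj₁ ∘ ∈-others⁻
      ; waiting-unheard = λ v∈ → unheard-∷ (proj₂ (∈-others⁻ v∈)) silent
      ; parent-adj      = λ { refl → uw }
      }
      where
      C = removeFrom w (nbrs G u)
      silent : ∀ {e} → e ∉ lg
      silent e∈ with Coherent.phase coh
      silent () | refl
    reaction-coherent (local ACTIVE p ch wt lg) uw coh = record
      { phase           = settle-phase p ch (removeFrom w wt) ((w , x) ∷ lg)
      ; waiting-adj     = Coherent.waiting-adj coh ∘ proj₁ ∘ kept
      ; waiting-unheard = λ v∈ → unheard-∷ (proj₂ (kept v∈)) (Coherent.waiting-unheard coh (proj₁ (kept v∈)))
      ; parent-adj      = Coherent.parent-adj coh
      }
      where
      kept : ∀ {v} → v ∈ removeFrom w wt → v ∈ wt × v ≢ w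
      kept = ∈-filter⁻ (λ v → ¬? (v ≟ w))
    reaction-coherent (local DONE p ch wt lg) uw coh = record
      { phase           = Coherent.phase coh
      ; waiting-adj     = Coherent.waiting-adj coh
      ; waiting-unheard = λ v∈ → ⊥-elim (idle v∈)
      ; parent-adj      = Coherent.parent-adj coh
      }
      where
      idle : ∀ {v} → v ∉ wt
      idle v∈ with Coherent.phase coh
      idle () | refl

    reaction-budget : ∀ s → budget (proj₁ (reaction u s w x)) + length (proj₂ (reaction u s w x)) ≤ budget s
    reaction-budget (local INIT _ _ _ lg) = begin
      budget s′ + length (sendAll u C ++ R)    ≡⟨ cong (budget s′ +_) (trans (length-++ (sendAll u C))
                                                    (cong (_+ length R) (length-map _ C))) ⟩
      budget s′ + (length C + length R)        ≡⟨ exchange (budget s′) (length C) (length R) ⟩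
      length C + (budget s′ + length R)        ≡⟨ cong (length C +_) (settle-budget u (just w) C C ((w , x) ∷ lg)) ⟩
      length C + 1                             ≡⟨ +-comm (length C) 1 ⟩
      suc (length C)                           ≤⟨ s≤s (others-bound u w) ⟩
      suc n                                    ∎
      where
      open ≤-Reasoning
      C = removeFrom w (nbrs G u)
      R = report u C (just w)
      s′ = local (settle C) (just w) C C ((w , x) ∷ lg)
      exchange : ∀ a b c → a + (b + c) ≡ b + (a + c)
      exchange = solve-∀
    reaction-budget (local ACTIVE p ch wt lg) =
      ≤-reflexive (settle-budget u p ch (removeFrom w wt) ((w , x) ∷ lg))
    reaction-budget (local DONE _ _ _ _) = z≤n

  update-here : ∀ u s (N : Fin n → Local n M) → update u s N u ≡ s
  update-here u s N with u ≟ u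
  ... | yes _  = refl
  ... | no u≢u = ⊥-elim (u≢u refl)

  update-elsewhere : ∀ u s (N : Fin n → Local n M) {a} → a ≢ u → update u s N a ≡ N a
  update-elsewhere u s N {a} a≢u with a ≟ u
  ... | yes a≡u = ⊥-elim (a≢u a≡u)
  ... | no _    = refl

  update-elim : ∀ (P : Fin n → Local n M → Set) u s N a → P u s → (a ≢ u → P a (N a)) → P a (update u s N a)
  update-elim P u s N a at-u elsewhere with a ≟ u
  ... | yes refl = at-u
  ... | no a≢u   = elsewhere a≢u

  potential : Config n M → ℕ
  potential c = length (pending c) + sum (λ a → budget (nodes c a))

  delivery-arith : ∀ a b o s′ s R → s′ + o ≤ s → a + (b + o) + (s′ + R) < a + suc b + (s + R)
  delivery-arith a b o s′ s R le = begin-strict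
    a + (b + o) + (s′ + R) ≡⟨ regroup a b o s′ R ⟩
    (a + b + R) + (s′ + o) ≤⟨ +-monoʳ-≤ (a + b + R) le ⟩
    (a + b + R) + s        <⟨ n<1+n _ ⟩
    suc (a + b + R + s)    ≡⟨ regroup′ a b s R ⟩
    a + suc b + (s + R)    ∎
    where
    open ≤-Reasoning
    regroup : ∀ a b o s′ R → a + (b + o) + (s′ + R) ≡ (a + b + R) + (s′ + o)
    regroup = solve-∀
    regroup′ : ∀ a b s R → suc (a + b + R + s) ≡ a + suc b + (s + R)
    regroup′ = solve-∀

  delivery-decreases : ∀ c xs e ys u s′ out → pending c ≡ xs ++ e ∷ ys →
    budget s′ + length out ≤ budget (nodes c u) →
    potential (config (update u s′ (nodes c)) (xs ++ ys ++ out)) < potential c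
  delivery-decreases c xs e ys u s′ out split spend
    with sum-update (λ a → budget (nodes c a)) (λ a → budget (update u s′ (nodes c) a)) u
           (λ a a≢u → cong budget (update-elsewhere u s′ (nodes c) a≢u))
  ... | rest , old-sum , new-sum = begin-strict
    length (xs ++ ys ++ out) + sum (λ a → budget (update u s′ (nodes c) a))
      ≡⟨ cong₂ _+_ (trans (length-++ xs) (cong (length xs +_) (length-++ ys)))
                   (trans new-sum (cong (λ t → budget t + rest) (update-here u s′ (nodes c)))) ⟩
    length xs + (length ys + length out) + (budget s′ + rest)
      <⟨ delivery-arith (length xs) (length ys) (length out) (budget s′) _ rest spend ⟩
    length xs + suc (length ys) + (budget (nodes c u) + rest)
      ≡⟨ sym (cong₂ _+_ (trans (cong length split) (length-++ xs)) old-sum) ⟩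
    potential c ∎
    where open ≤-Reasoning

  step-decreases : ∀ {c c′} → Step c c′ → potential c′ < potential c
  step-decreases {c} (deliver xs w u x ys split) rewrite react-spec u (nodes c u) w x =
    delivery-decreases c xs _ ys u _ _ split (reaction-budget (nodes c u))

  terminates : WellFounded (λ c′ c → Step c c′)
  terminates = ranked⇒wf (potential , step-decreases)

  record Invariant (r : Fin n) (c : Config n M) : Set where
    field
      coherent       : ∀ a → Coherent a (nodes c a)
      root-started   : Started (nodes c r)
      parent-started : ∀ {a b} → ParentOf (nodes c) a b → Started (nodes c b)
      in-transit     : ∀ {a b z} → (a , b , z) ∈ pending c → Started (nodes c a) × Adj G a b
      sent-accounted : ∀ {a b} → Adj G a b → HasSent (nodes c a) b →
                       (a , b , m a b) ∈ pending c ⊎ (a , m a b) ∈ log (nodes c b)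
      parents-ranked : Ranked (ParentOf (nodes c))

  module Initially (r : Fin n) where
    root₀ : Local n M
    root₀ = local (settle (nbrs G r)) nothing (nbrs G r) (nbrs G r) []

    nodes₀ : Fin n → Local n M
    nodes₀ = update r root₀ (λ _ → initLocal)

    initial-spec : initial r ≡ config nodes₀ (sendAll r (nbrs G r))
    initial-spec = cong (λ t → config (update r t (λ _ → initLocal)) (sendAll r (nbrs G r)))
                        (cong proj₁ (tryFinish-spec r ACTIVE nothing (nbrs G r) (nbrs G r) [] []))

    root₀-started : Started (nodes₀ r)
    root₀-started = subst Started (sym (update-here r root₀ _)) (settle-started (nbrs G r))

    orphans : ∀ {a b} → ¬ ParentOf nodes₀ a b
    orphans {a} {b} = update-elim (λ _ t → parent t ≢ just b) r root₀ _ a (λ ()) (λ _ ())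

    coherent₀ : ∀ a → Coherent a (nodes₀ a)
    coherent₀ a = update-elim Coherent r root₀ _ a root-coherent (λ _ → sleeper-coherent)
      where
      root-coherent : Coherent r root₀
      root-coherent = record
        { phase = settle-phase nothing (nbrs G r) (nbrs G r) [] ; waiting-adj = ∈-nbrs⁻
        ; waiting-unheard = λ _ () ; parent-adj = λ () }
      sleeper-coherent : Coherent a initLocal
      sleeper-coherent = record { phase = refl ; waiting-adj = λ () ; waiting-unheard = λ () ; parent-adj = λ () }

    invariant₀ : Invariant r (config nodes₀ (sendAll r (nbrs G r)))
    invariant₀ = record
      { coherent       = coherent₀
      ; root-started   = root₀-started
      ; parent-started = λ {a} {b} pe → ⊥-elim (orphans {a} {b} pe)
      ; in-transit     = λ e∈ → case-root (∈-sendAll⁻ e∈)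
      ; sent-accounted = accounted₀
      ; parents-ranked = (λ _ → 0) , λ {a} {b} pe → ⊥-elim (orphans {a} {b} pe)
      }
      where
      case-root : ∀ {a b} → a ≡ r × b ∈ nbrs G r → Started (nodes₀ a) × Adj G a b
      case-root (refl , b∈) = root₀-started , ∈-nbrs⁻ b∈
      sleeper-silent : ∀ {b} {A : Set} → HasSent initLocal b → A
      sleeper-silent (finished ())
      sleeper-silent (not-to-parent () _)
      accounted₀ : ∀ {a b} → Adj G a b → HasSent (nodes₀ a) b →
                   (a , b , m a b) ∈ sendAll r (nbrs G r) ⊎ (a , m a b) ∈ log (nodes₀ b)
      accounted₀ {a} {b} = update-elim
        (λ q t → Adj G q b → HasSent t b → (q , b , m q b) ∈ sendAll r (nbrs G r) ⊎ (q , m q b) ∈ log (nodes₀ b))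
        r root₀ _ a (λ rb _ → inj₁ (∈-sendAll⁺ (∈-nbrs⁺ rb))) (λ _ _ → sleeper-silent)

    invariant-initial : Invariant r (initial r)
    invariant-initial = subst (Invariant r) (sym initial-spec) invariant₀

  module Preservation {r c} (I : Invariant r c) (xs : List (Msg n M)) (w u : Fin n) (x : M)
                      (ys : List (Msg n M)) (split : pending c ≡ xs ++ (w , u , x) ∷ ys) where
    open Invariant I

    N : Fin n → Local n M
    N = nodes c
    s′ : Local n M
    s′ = proj₁ (reaction u (N u) w x)
    out : List (Msg n M)
    out = proj₂ (reaction u (N u) w x)
    N′ : Fin n → Local n M
    N′ = update u s′ N
    P′ : List (Msg n M)
    P′ = xs ++ ys ++ out

    sender : Started (N w) × Adj G w u
    sender = in-transit (subst ((w , u , x) ∈_) (sym split) (∈-++⁺ʳ xs (here refl)))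

    u-adj-w : Adj G u w
    u-adj-w = Graph.sym G (proj₂ sender)

    pending-remains : ∀ {e} → e ∈ pending c → e ≡ (w , u , x) ⊎ e ∈ P′
    pending-remains e∈ with ∈-++⁻ xs (subst (_ ∈_) split e∈)
    ... | inj₁ e∈xs         = inj₂ (∈-++⁺ˡ e∈xs)
    ... | inj₂ (here e≡)    = inj₁ e≡
    ... | inj₂ (there e∈ys) = inj₂ (∈-++⁺ʳ xs (∈-++⁺ˡ e∈ys))

    pending-origin : ∀ {e} → e ∈ P′ → e ∈ pending c ⊎ e ∈ out
    pending-origin e∈ with ∈-++⁻ xs e∈
    ... | inj₁ e∈xs = inj₁ (subst (_ ∈_) (sym split) (∈-++⁺ˡ e∈xs))
    ... | inj₂ e∈ with ∈-++⁻ ys e∈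
    ...   | inj₁ e∈ys  = inj₁ (subst (_ ∈_) (sym split) (∈-++⁺ʳ xs (there e∈ys)))
    ...   | inj₂ e∈out = inj₂ e∈out

    stays-started : ∀ a → Started (N a) → Started (N′ a)
    stays-started a started = update-elim (λ _ t → Started t) u s′ N a (reaction-started (N u)) (λ _ → started)

    log-grows : ∀ b {e} → e ∈ log (N b) → e ∈ log (N′ b)
    log-grows b {e} = update-elim (λ q t → e ∈ log (N q) → e ∈ log t) u s′ N b
      (λ e∈ → subst (e ∈_) (sym (reaction-log (N u))) (there e∈)) (λ _ e∈ → e∈)

    delivered-logged : ∀ {a b z} → (a , b , z) ≡ (w , u , x) → (a , z) ∈ log (N′ b)
    delivered-logged refl =
      subst (λ t → (w , x) ∈ log t) (sym (update-here u s′ N))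
            (subst ((w , x) ∈_) (sym (reaction-log (N u))) (here refl))

    new-parent : ∀ {a b} → ParentOf N′ a b → (a ≡ u × status (N u) ≡ INIT × b ≡ w) ⊎ ParentOf N a b
    new-parent {a} {b} = update-elim (λ q t → parent t ≡ just b → (q ≡ u × _) ⊎ ParentOf N q b) u s′ N a
      (λ p≡b → Sum.map (λ (s-init , b≡w) → refl , s-init , b≡w) proj₂ (reaction-parent (N u) p≡b))
      (λ _ → inj₂)

    sent-before-or-now : ∀ {a b} → Adj G a b → HasSent (N′ a) b → HasSent (N a) b ⊎ (a , b , m a b) ∈ P′
    sent-before-or-now {a} {b} = update-elim (λ q t → Adj G q b → HasSent t b → HasSent (N q) b ⊎ (q , b , m q b) ∈ P′)
      u s′ N a (λ ub sent → map₂ (∈-++⁺ʳ xs ∘ ∈-++⁺ʳ ys) (reaction-sent (N u) ub sent)) (λ _ _ → inj₁)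

    sent-accounted′ : ∀ {a b} → Adj G a b → HasSent (N′ a) b → (a , b , m a b) ∈ P′ ⊎ (a , m a b) ∈ log (N′ b)
    sent-accounted′ {b = b} ab sent with sent-before-or-now ab sent
    ... | inj₂ now = inj₁ now
    ... | inj₁ before with sent-accounted ab before
    ...   | inj₂ logged = inj₂ (log-grows b logged)
    ...   | inj₁ in-transit-before with pending-remains in-transit-before
    ...     | inj₁ delivered = inj₂ (delivered-logged delivered)
    ...     | inj₂ still     = inj₁ still

    in-transit′ : ∀ {a b z} → (a , b , z) ∈ P′ → Started (N′ a) × Adj G a b
    in-transit′ {a} e∈ with pending-origin e∈
    ... | inj₁ old = stays-started a (proj₁ (in-transit old)) , proj₂ (in-transit old)
    ... | inj₂ new with reaction-out (N u) u-adj-w (coherent u) new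
    ...   | refl , ub = subst Started (sym (update-here u s′ N)) (reaction-started (N u)) , ub

    parent-started′ : ∀ {a b} → ParentOf N′ a b → Started (N′ b)
    parent-started′ {a} {b} pe with new-parent {a} pe
    ... | inj₁ (_ , _ , refl) = stays-started w (proj₁ sender)
    ... | inj₂ old            = stays-started b (parent-started {a} old)

    -- a woken node becomes a fresh leaf below its sender; otherwise the
    -- parent pointers do not change
    parents-ranked′ : Ranked (ParentOf N′)
    parents-ranked′ with init? (status (N u))
    ... | yes u-init = ranked-attach u parents-ranked fresh-leaf
      where
      fresh-leaf : ∀ {a b} → ParentOf N′ a b → b ≢ u × (a ≡ u ⊎ ParentOf N a b)
      fresh-leaf pe with new-parent pe
      ... | inj₁ (a≡u , _ , refl) = (λ w≡u → Graph.irrefl G (subst (Adj G u) w≡u u-adj-w)) , inj₁ a≡u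
      ... | inj₂ old = (λ b≡u → parent-started old (subst (λ q → status (N q) ≡ INIT) (sym b≡u) u-init)) , inj₂ old
    ... | no u-started = proj₁ parents-ranked , proj₂ parents-ranked ∘ kept
      where
      kept : ∀ {a b} → ParentOf N′ a b → ParentOf N a b
      kept pe with new-parent pe
      ... | inj₁ (_ , u-init , _) = ⊥-elim (u-started u-init)
      ... | inj₂ old              = old

    invariant′ : Invariant r (config N′ P′)
    invariant′ = record
      { coherent       = λ a → update-elim Coherent u s′ N a (reaction-coherent (N u) u-adj-w (coherent u)) (λ _ → coherent a)
      ; root-started   = stays-started r root-started
      ; parent-started = λ {a} → parent-started′ {a}
      ; in-transit     = in-transit′
      ; sent-accounted = sent-accounted′
      ; parents-ranked = parents-ranked′
      }

  invariant-step : ∀ {r c c′} → Invariant r c → Step c c′ → Invariant r c′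
  invariant-step {c = c} I (deliver xs w u x ys split) rewrite react-spec u (nodes c u) w x =
    Preservation.invariant′ I xs w u x ys split

  invariant-reachable : ∀ {r c} → Star Step (initial r) c → Invariant r c
  invariant-reachable {r} = go (Initially.invariant-initial r)
    where
    go : ∀ {c c′} → Invariant r c → Star Step c c′ → Invariant r c′
    go I ε          = I
    go I (st ◅ run) = go (invariant-step I st) run

  module Quiescent {r c} (connected : Connected G) (I : Invariant r c) (silent : pending c ≡ []) where
    open Invariant I

    N : Fin n → Local n M
    N = nodes c

    received : ∀ {a b} → Adj G a b → HasSent (N a) b → (a , m a b) ∈ log (N b)
    received ab sent with sent-accounted ab sent
    ... | inj₂ logged = logged
    ... | inj₁ e∈ with subst (_ ∈_) silent e∈
    ...   | ()

    phase-of : ∀ {a st} → status (N a) ≡ st → Phase st (N a)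
    phase-of {a} s≡ = subst (λ st → Phase st (N a)) s≡ (Coherent.phase (coherent a))

    -- a started node has either sent to a sleeping neighbour (impossible: it
    -- would have heard) or is its child (impossible: parents have started)
    started-spreads : ∀ {a b} → Adj G a b → Started (N a) → Started (N b)
    started-spreads ab a-started b-init with sent-or-parent a-started
    ... | inj₂ (_ , pe) = parent-started pe b-init
    ... | inj₁ sent with subst (_ ∈_) (phase-of b-init) (received ab sent)
    ...   | ()

    all-started : ∀ a → Started (N a)
    all-started a = along (connected r a) root-started
      where
      along : ∀ {a b} → Star (Adj G) a b → Started (N a) → Started (N b)
      along ε          started = started
      along (ab ◅ abs) started = along abs (started-spreads ab started)

    -- an active node awaits a neighbour that has not sent to it, hence an
    -- active child; descending through children must stop
    none-active : ∀ a → Acc (ParentOf N) a → status (N a) ≢ ACTIVE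
    none-active a (acc below) active with phase-of active
    ... | y , y∈ with sent-or-parent {b = a} (all-started y)
    ...   | inj₁ sent          = Coherent.waiting-unheard (coherent a) y∈
                                   (received (Graph.sym G (Coherent.waiting-adj (coherent a) y∈)) sent)
    ...   | inj₂ (y-active , pe) = none-active y (below pe) y-active

    all-done : ∀ a → status (N a) ≡ DONE
    all-done a with status (N a) | all-started a | none-active a (ranked⇒wf parents-ranked a)
    ... | INIT   | started | _      = ⊥-elim (started refl)
    ... | ACTIVE | _       | active = ⊥-elim (active refl)
    ... | DONE   | _       | _      = refl

    all-received : ∀ u v → Adj G u v → (v , m v u) ∈ log (N u)
    all-received u v uv = received (Graph.sym G uv) (finished (all-done v))

lemma10 : ∀ {n} (G : Graph n) → Connected G → {M : Set} (m : Fin n → Fin n → M) (r : Fin n) →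
    Acc (λ c′ c → Algorithm3.Step G m c c′) (Algorithm3.initial G m r)
    × (∀ c → Star (Algorithm3.Step G m) (Algorithm3.initial G m r) c → pending c ≡ [] →
         (∀ u → status (nodes c u) ≡ DONE)
         × (∀ u v → Adj G u v → (v , m v u) ∈ log (nodes c u)))
lemma10 G connected m r =
  terminates (Algorithm3.initial G m r) ,
  λ c run silent → let open Quiescent connected (invariant-reachable run) silent in all-done , all-received
  where open Synchronizer G m
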